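{- Let $G$ be a graph and let $H$ be a bipartite graph with partite sets $A$ and $B$, where $|A|=a$ and $|B|=b$. Let $\delta = \min_{v \in B} d_H(v)$. If $b \geq \bigl(P_\ell(G, \chi_\ell(G) + \delta - 1)\bigr)^a$, then $\chi_\ell(G \square H) \geq \chi_\ell(G) + \delta$.
   Context: All graphs are finite, simple and nonempty. $d_H(v)$ is the degree of $v$ in $H$. A list assignment $L$ for a graph assigns to each vertex $v$ a set $L(v)$ of colors; a proper $L$-coloring is a proper coloring $c$ with $c(v)\in L(v)$ for all $v$. $L$ is a $k$-assignment if $|L(v)|=k$ for all $v$. $\chi_\ell(G)$ is the least $k$ such that $G$ has a proper $L$-coloring for every $k$-assignment $L$. The list color function $P_\ell(G,k)$ is the minimum, over all $k$-assignments $L$ for $G$, of the number of proper $L$-colorings of $G$. The Cartesian product $G \square H$ has vertex set $V(G)\times V(H)$, with $(u,v)$ adjacent to $(u',v')$ iff either $u=u'$ and $vv'\in E(H)$, or $v=v'$ and $uu'\in E(G)$. -}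

module Defs where

open import Data.Nat using (ℕ; zero; suc; _+_; _≤_; _<_; _≡ᵇ_)
open import Data.Fin using (Fin; zero; suc)
open import Data.Bool using (Bool; true; false; not; _∧_; _∨_; if_then_else_)
open import Data.List using (List; []; _∷_; [_]; map; concatMap; allFin)
open import Data.Nat.ListAction using (sum)
open import Data.Bool.ListAction using (and)
open import Data.Product using (Σ; ∃; _×_; _,_)
open import Relation.Binary.PropositionalEquality using (_≡_; _≢_)
open import Relation.Nullary using (¬_)
open import Function.Definitions using (Injective)
open import Data.Fin using (_≟_)
open import Relation.Nullary.Decidable using (⌊_⌋)

record Graph : Set where
  field
    n        : ℕ
    adj      : Fin n → Fin n → Bool
    adj-sym  : ∀ u v → adj u v ≡ adj v u
    irrefl   : ∀ v → adj v v ≡ false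
    nonempty : 1 ≤ n

open Graph public

-- L is a k-assignment: each L(v) is a set of exactly k colours,
-- given as an injective enumeration Fin k → ℕ.
IsKAssignment : {V : Set} (k : ℕ) → (V → Fin k → ℕ) → Set
IsKAssignment k L = ∀ v → Injective _≡_ _≡_ (L v)

IsProperLColoring : {V : Set} {k : ℕ} (adj : V → V → Bool) →
                    (V → Fin k → ℕ) → (V → ℕ) → Set
IsProperLColoring adj L c =
  (∀ v → ∃ λ i → L v i ≡ c v) × (∀ u v → adj u v ≡ true → c u ≢ c v)

Choosable : {V : Set} (adj : V → V → Bool) (k : ℕ) → Set
Choosable {V} adj k =
  ∀ (L : V → Fin k → ℕ) → IsKAssignment k L →
  ∃ λ (c : V → ℕ) → IsProperLColoring adj L c

IsListChromaticNumber : {V : Set} (adj : V → V → Bool) (χ : ℕ) → Set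
IsListChromaticNumber adj χ =
  Choosable adj χ × (∀ j → j < χ → ¬ Choosable adj j)

-- Since each L(v) is enumerated injectively by Fin k, the L-colourings
-- c correspond bijectively to choice functions f : Fin n → Fin k
-- (c v = L v (f v)); we enumerate all such f explicitly.

consF : {n k : ℕ} → Fin k → (Fin n → Fin k) → Fin (suc n) → Fin k
consF i f zero    = i
consF i f (suc x) = f x

allFuns : (n k : ℕ) → List (Fin n → Fin k)
allFuns zero    k = [ (λ ()) ]
allFuns (suc n) k = concatMap (λ i → map (consF i) (allFuns n k)) (allFin k)

isProperᵇ : {n k : ℕ} → (Fin n → Fin n → Bool) →
            (Fin n → Fin k → ℕ) → (Fin n → Fin k) → Bool
isProperᵇ {n} adj L f =
  and (concatMap (λ u → map (λ v → not (adj u v) ∨ not (L u (f u) ≡ᵇ L v (f v)))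
                            (allFin n))
                 (allFin n))

numLColorings : (G : Graph) {k : ℕ} → (Fin (n G) → Fin k → ℕ) → ℕ
numLColorings G {k} L =
  sum (map (λ f → if isProperᵇ (adj G) L f then 1 else 0) (allFuns (n G) k))

IsListColorFunctionValue : (G : Graph) (k p : ℕ) → Set
IsListColorFunctionValue G k p =
  (Σ (Fin (n G) → Fin k → ℕ) λ L → IsKAssignment k L × numLColorings G L ≡ p)
  × (∀ (L : Fin (n G) → Fin k → ℕ) → IsKAssignment k L → p ≤ numLColorings G L)

countᵇ : {m : ℕ} → (Fin m → Bool) → ℕ
countᵇ {m} P = sum (map (λ x → if P x then 1 else 0) (allFin m))

degree : (H : Graph) → Fin (n H) → ℕ
degree H v = countᵇ (adj H v)

-- part : vertices with part false form A, with part true form B;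
-- every edge joins A and B.
IsBipartition : (H : Graph) → (Fin (n H) → Bool) → Set
IsBipartition H part = ∀ u v → adj H u v ≡ true → part u ≢ part v

IsMinDegreeOnB : (H : Graph) → (Fin (n H) → Bool) → ℕ → Set
IsMinDegreeOnB H part δ =
  (∃ λ v → part v ≡ true × degree H v ≡ δ)
  × (∀ v → part v ≡ true → δ ≤ degree H v)

boxAdj : (G H : Graph) → (Fin (n G) × Fin (n H)) → (Fin (n G) × Fin (n H)) → Bool
boxAdj G H (u , v) (u' , v') =
  (⌊ u ≟ u' ⌋ ∧ adj H v v')
  ∨ (⌊ v ≟ v' ⌋ ∧ adj G u u')

-- Write χ = χ₀ + 1 and let K be a (χ₀ + δ)-assignment of G with exactly p proper
-- colorings. If G □ H were (χ₀ + δ)-choosable, then G would be χ₀-choosable: given a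
-- χ₀-assignment L, give each copy G × {x}, x ∈ A, the lists of K tagged by x. As b ≥ p^a,
-- the vertices of B can be labelled so that every family (φₓ)ₓ∈A of proper K-colorings
-- is the label of some y ∈ B. The list of (u, y) is L(u) (with a fresh tag) together with
-- the colors φₓ(u) tagged by x, for δ neighbors x of y. A proper coloring c of G □ H
-- restricts to proper K-colorings of the copies over A; at the vertex y labelled by this
-- family, c(u, y) cannot be φₓ(u) = c(u, x), so it comes from L(u), and c(-, y) is a
-- proper L-coloring of G.

module Submission where

open import Defs
open import Data.Nat using (ℕ; _+_; _∸_; _^_; _≤_)
open import Data.Bool using (Bool; not)
open import Data.Fin using (Fin)
open import Relation.Binary.PropositionalEquality using (_≡_)

open import Data.Bool using (true; false; T; if_then_else_; _∨_)
open import Data.Bool.Properties using (T-≡; T-∧; T-not-≡; ¬-not; ∨-zeroʳ)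
open import Data.Bool.ListAction using (and)
open import Data.Empty using (⊥-elim)
open import Data.Fin using (zero; suc; _≟_; toℕ; fromℕ; fromℕ<; inject₁; inject≤; splitAt; _↑ˡ_; _↑ʳ_)
open import Data.Fin.Properties
  using (toℕ<n; toℕ-injective; inject₁-injective; inject≤-injective; fromℕ≢inject₁; splitAt⁻¹-↑ˡ; splitAt⁻¹-↑ʳ)
open import Data.List using (List; []; _∷_; [_]; _++_; length; map; filter; lookup; allFin; cartesianProductWith)
open import Data.List.Membership.Propositional using (_∈_)
open import Data.List.Membership.Propositional.Properties using (∈-lookup; ∈-filter⁻)
open import Data.List.Properties using (length-map; length-++; map-tabulate)
open import Data.List.Relation.Unary.All as All using (All; []; _∷_)
import Data.List.Relation.Unary.All.Properties as All
open import Data.List.Relation.Unary.Any as Any using (Any; here; there)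
import Data.List.Relation.Unary.Any.Properties as Any
open import Data.List.Relation.Unary.AllPairs using (_∷_)
open import Data.List.Relation.Unary.Unique.Propositional using (Unique)
import Data.List.Relation.Unary.Unique.Propositional.Properties as Unique
open import Data.Nat using (zero; suc; _*_; _≡ᵇ_; s≤s; s≤s⁻¹) renaming (_≟_ to _≟ℕ_)
open import Data.Nat.DivMod using (_%_; [m+kn]%n≡m%n; m<n⇒m%n≡m)
open import Data.Nat.ListAction using (sum)
open import Data.Nat.Properties using (+-identityʳ; *-cancelʳ-≡; +-cancelˡ-≡; ≮⇒≥; n<1+n)
open import Data.Product using (∃; _×_; _,_; proj₁; proj₂)
open import Data.Sum using (inj₁; inj₂; [_,_]′)
open import Data.Unit using (tt)
import Data.Vec.Functional as Vector
open import Function using (_∘_; id; Equivalence)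
open import Function.Definitions using (Injective)
open import Relation.Binary.Definitions using (DecidableEquality)
open import Relation.Binary.PropositionalEquality
  using (refl; sym; trans; cong; cong₂; subst; subst₂; _≢_; _≗_; module ≡-Reasoning)
open import Relation.Nullary using (¬_; contradiction; does; yes; no)
open import Relation.Nullary.Decidable using (T?; dec-true; dec-false)

private
  variable
    A B X : Set
    m k : ℕ

length-filter-T? : (P : A → Bool) (xs : List A) →
  length (filter (T? ∘ P) xs) ≡ sum (map (λ x → if P x then 1 else 0) xs)
length-filter-T? P [] = refl
length-filter-T? P (x ∷ xs) with P x
... | true = cong suc (length-filter-T? P xs)
... | false = length-filter-T? P xs

length-cartesianProductWith : (f : A → B → X) (xs : List A) (ys : List B) →
  length (cartesianProductWith f xs ys) ≡ length xs * length ys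
length-cartesianProductWith f [] ys = refl
length-cartesianProductWith f (x ∷ xs) ys = begin
  length (map (f x) ys ++ cartesianProductWith f xs ys)
    ≡⟨ length-++ (map (f x) ys) ⟩
  length (map (f x) ys) + length (cartesianProductWith f xs ys)
    ≡⟨ cong₂ _+_ (length-map (f x) ys) (length-cartesianProductWith f xs ys) ⟩
  length ys + length xs * length ys ∎
  where open ≡-Reasoning

lookup-injective : {xs : List A} → Unique xs → ∀ i j → lookup xs i ≡ lookup xs j → i ≡ j
lookup-injective (_ ∷ _) zero zero _ = refl
lookup-injective (x∉xs ∷ _) zero (suc j) eq = contradiction eq (All.lookup x∉xs (∈-lookup j))
lookup-injective (x∉xs ∷ _) (suc i) zero eq = contradiction (sym eq) (All.lookup x∉xs (∈-lookup i))
lookup-injective (_ ∷ xs!) (suc i) (suc j) eq = cong suc (lookup-injective xs! i j eq)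

T-and⁺ : {bs : List Bool} → All T bs → T (and bs)
T-and⁺ [] = tt
T-and⁺ (t ∷ ts) = Equivalence.from T-∧ (t , T-and⁺ ts)

countᵇ-suc : (P : Fin (suc m) → Bool) →
  countᵇ P ≡ (if P zero then 1 else 0) + countᵇ (P ∘ suc)
countᵇ-suc P = cong (λ xs → (if P zero then 1 else 0) + sum xs)
  (trans (map-tabulate suc (λ x → if P x then 1 else 0))
         (sym (map-tabulate id (λ x → if P (suc x) then 1 else 0))))

module _ {A B : Set} (_≟_ : DecidableEquality A) where

  assign : List A → List B → B → A → B
  assign (y ∷ ys) (c ∷ cs) d x = if does (x ≟ y) then c else assign ys cs d x
  assign _        _        d x = d

  assign-head : ∀ {y ys c cs} d → assign (y ∷ ys) (c ∷ cs) d y ≡ c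
  assign-head {y} d rewrite dec-true (y ≟ y) refl = refl

  assign-tail : ∀ {x y ys c cs} d → x ≢ y → assign (y ∷ ys) (c ∷ cs) d x ≡ assign ys cs d x
  assign-tail {x} {y} d x≢y rewrite dec-false (x ≟ y) x≢y = refl

  assign-covers : {Q : B → Set} {ys : List A} {cs : List B} (d : B) →
    Unique ys → length cs ≤ length ys → Any Q cs →
    ∃ λ y → y ∈ ys × Q (assign ys cs d y)
  assign-covers {Q} {y ∷ ys} {c ∷ cs} d _ _ (here qc) =
    y , here refl , subst Q (sym (assign-head {ys = ys} {cs = cs} d)) qc
  assign-covers {Q} {y ∷ ys} {c ∷ cs} d (y∉ys ∷ ys!) (s≤s le) (there q) =
    let x , x∈ys , qx = assign-covers d ys! le q
        x≢y = λ x≡y → All.lookup y∉ys x∈ys (sym x≡y)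
    in x , there x∈ys , subst Q (sym (assign-tail {ys = ys} {c} {cs} d x≢y)) qx

selections : (m : ℕ) → (Fin m → Bool) → List X → X → List (Fin m → X)
selections zero    P xs d = [ (λ ()) ]
selections (suc m) P xs d =
  cartesianProductWith Vector._∷_ (if P zero then [ d ] else xs) (selections m (P ∘ suc) xs d)

length-selections : (P : Fin m → Bool) (xs : List X) (d : X) →
  length (selections m P xs d) ≡ length xs ^ countᵇ (not ∘ P)
length-selections {m = zero} P xs d = refl
length-selections {m = suc m} P xs d = begin
  length (selections (suc m) P xs d)
    ≡⟨ length-cartesianProductWith Vector._∷_ (if P zero then [ d ] else xs) _ ⟩
  length (if P zero then [ d ] else xs) * length (selections m (P ∘ suc) xs d)
    ≡⟨ cong (length (if P zero then [ d ] else xs) *_) (length-selections (P ∘ suc) xs d) ⟩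
  length (if P zero then [ d ] else xs) * length xs ^ countᵇ (not ∘ P ∘ suc)
    ≡⟨ firstFactor (P zero) ⟩
  length xs ^ ((if not (P zero) then 1 else 0) + countᵇ (not ∘ P ∘ suc))
    ≡⟨ cong (length xs ^_) (countᵇ-suc (not ∘ P)) ⟨
  length xs ^ countᵇ (not ∘ P) ∎
  where
  open ≡-Reasoning
  firstFactor : ∀ b → length (if b then [ d ] else xs) * length xs ^ countᵇ (not ∘ P ∘ suc)
                    ≡ length xs ^ ((if not b then 1 else 0) + countᵇ (not ∘ P ∘ suc))
  firstFactor true  = +-identityʳ _
  firstFactor false = refl

selections-complete : {P : Fin m → Bool} {xs : List X} {d : X} (R : Fin m → X → Set) →
  (∀ x → P x ≡ false → Any (R x) xs) →
  Any (λ Φ → ∀ x → P x ≡ false → R x (Φ x)) (selections m P xs d)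
selections-complete {m = zero} R choices = here (λ ())
selections-complete {m = suc m} {P = P} {xs} {d} R choices =
  Any.cartesianProductWith⁺ Vector._∷_ extend (atZero (P zero) refl)
    (selections-complete (R ∘ suc) (choices ∘ suc))
  where
  atZero : ∀ b → P zero ≡ b → Any (λ o → P zero ≡ false → R zero o) (if b then [ d ] else xs)
  atZero true  P0 = here (λ P0' → contradiction (trans (sym P0) P0') λ ())
  atZero false P0 = Any.map (λ r _ → r) (choices zero P0)
  extend : ∀ {o Φ} → (P zero ≡ false → R zero o) → (∀ x → P (suc x) ≡ false → R (suc x) (Φ x)) →
           ∀ x → P x ≡ false → R x ((o Vector.∷ Φ) x)
  extend r q zero    = r
  extend r q (suc x) = q x

allFuns-complete : (f : Fin m → Fin k) → Any (_≗ f) (allFuns m k)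
allFuns-complete {m = zero}  f = here (λ ())
allFuns-complete {m = suc m} f =
  Any.concatMap⁺ _ (Any.tabulate⁺ (f zero) (Any.map⁺ (Any.map consF-≗ (allFuns-complete (f ∘ suc)))))
  where
  consF-≗ : ∀ {g} → g ≗ f ∘ suc → consF (f zero) g ≗ f
  consF-≗ g≗f zero    = refl
  consF-≗ g≗f (suc x) = g≗f x

isProperᵇ-complete : {N : ℕ} (adj : Fin N → Fin N → Bool) (L : Fin N → Fin k → ℕ) (f : Fin N → Fin k) →
  (∀ u v → adj u v ≡ true → L u (f u) ≢ L v (f v)) → T (isProperᵇ adj L f)
isProperᵇ-complete adj L f proper =
  T-and⁺ (All.concat⁺ (All.map⁺ (All.tabulate⁺ λ u → All.map⁺ (All.tabulate⁺ (entry u)))))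
  where
  entry : ∀ u v → T (not (adj u v) ∨ not (L u (f u) ≡ᵇ L v (f v)))
  entry u v with adj u v in uv
  ... | false = tt
  ... | true  = Equivalence.from T-not-≡
                  (dec-false (L u (f u) ≟ℕ L v (f v)) (proper u v uv))

lColorings : (G : Graph) → (Fin (n G) → Fin k → ℕ) → List (Fin (n G) → ℕ)
lColorings {k} G L = map (λ f u → L u (f u)) (filter (T? ∘ isProperᵇ (adj G) L) (allFuns (n G) k))

length-lColorings : (G : Graph) (L : Fin (n G) → Fin k → ℕ) → length (lColorings G L) ≡ numLColorings G L
length-lColorings {k} G L =
  trans (length-map _ (filter (T? ∘ isProperᵇ (adj G) L) (allFuns (n G) k)))
        (length-filter-T? (isProperᵇ (adj G) L) (allFuns (n G) k))

lColorings-complete : (G : Graph) (L : Fin (n G) → Fin k → ℕ) {c : Fin (n G) → ℕ} →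
  IsProperLColoring (adj G) L c → Any (_≗ c) (lColorings G L)
lColorings-complete {k} G L {c} (inL , proper) =
  Any.map⁺ (Any.map colors-c inFiltered)
  where
  f : Fin (n G) → Fin k
  f u = proj₁ (inL u)
  colors-c : ∀ {g} → g ≗ f → ∀ u → L u (g u) ≡ c u
  colors-c g≗f u = trans (cong (L u) (g≗f u)) (proj₂ (inL u))
  T-isProperᵇ : ∀ {g} → g ≗ f → T (isProperᵇ (adj G) L g)
  T-isProperᵇ {g} g≗f = isProperᵇ-complete (adj G) L g λ u v uv eq →
    proper u v uv (trans (sym (colors-c g≗f u)) (trans eq (colors-c g≗f v)))
  found : Any (_≗ f) (allFuns (n G) k)
  found = allFuns-complete f
  inFiltered : Any (_≗ f) (filter (T? ∘ isProperᵇ (adj G) L) (allFuns (n G) k))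
  inFiltered = [ id , (λ notProper → contradiction (T-isProperᵇ (Any.lookup-result found)) notProper) ]′
                 (Any.filter⁺ (T? ∘ isProperᵇ (adj G) L) found)

-- Opaque, so that unification does not unfold it and can infer the arguments of encode-injective.
opaque
  encode : (N : ℕ) → ℕ → Fin (suc N) → ℕ
  encode N m s = toℕ s + m * suc N

  encode-injective : ∀ N {m m′ s s′} → encode N m s ≡ encode N m′ s′ → m ≡ m′ × s ≡ s′
  encode-injective N {m} {m′} {s} {s′} eq = m≡m′ , toℕ-injective s≡s′
    where
    open ≡-Reasoning
    s≡s′ : toℕ s ≡ toℕ s′
    s≡s′ = begin
      toℕ s                        ≡⟨ m<n⇒m%n≡m (toℕ<n s) ⟨
      toℕ s % suc N                ≡⟨ [m+kn]%n≡m%n (toℕ s) m (suc N) ⟨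
      encode N m s % suc N         ≡⟨ cong (_% suc N) eq ⟩
      encode N m′ s′ % suc N       ≡⟨ [m+kn]%n≡m%n (toℕ s′) m′ (suc N) ⟩
      toℕ s′ % suc N               ≡⟨ m<n⇒m%n≡m (toℕ<n s′) ⟩
      toℕ s′                       ∎
    m≡m′ : m ≡ m′
    m≡m′ = *-cancelʳ-≡ m m′ (suc N) (+-cancelˡ-≡ (toℕ s) _ _ (trans eq (cong (_+ m′ * suc N) (sym s≡s′))))

++-injective-disjoint : {xs : Vector.Vector A m} {ys : Vector.Vector A k} →
  Injective _≡_ _≡_ xs → Injective _≡_ _≡_ ys → (∀ i j → xs i ≢ ys j) →
  Injective _≡_ _≡_ (xs Vector.++ ys)
++-injective-disjoint {m = m} xs-inj ys-inj disjoint {i} {j} eq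
  with splitAt m i in split-i | splitAt m j in split-j
... | inj₁ i′ | inj₁ j′ =
  trans (sym (splitAt⁻¹-↑ˡ split-i)) (trans (cong (_↑ˡ _) (xs-inj eq)) (splitAt⁻¹-↑ˡ split-j))
... | inj₂ i′ | inj₂ j′ =
  trans (sym (splitAt⁻¹-↑ʳ split-i)) (trans (cong (m ↑ʳ_) (ys-inj eq)) (splitAt⁻¹-↑ʳ split-j))
... | inj₁ i′ | inj₂ j′ = contradiction eq (disjoint i′ j′)
... | inj₂ i′ | inj₁ j′ = contradiction (sym eq) (disjoint j′ i′)

Choosable-mono : {V : Set} (adj : V → V → Bool) {j k : ℕ} → j ≤ k → Choosable adj j → Choosable adj k
Choosable-mono adj j≤k choose L L-inj =
  let c , inL , proper = choose (λ v i → L v (inject≤ i j≤k)) (λ v eq → inject≤-injective _ _ _ _ (L-inj v eq))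
  in c , (λ v → let i , eq = inL v in inject≤ i j≤k , eq) , proper

¬Choosable-zero : (G : Graph) → ¬ Choosable (adj G) 0
¬Choosable-zero G choose with choose (λ _ ()) (λ { _ {()} })
... | _ , inL , _ with inL (fromℕ< (nonempty G))
... | () , _

boxAdj-G-edge : (G H : Graph) {u v : Fin (n G)} {x : Fin (n H)} →
  adj G u v ≡ true → boxAdj G H (u , x) (v , x) ≡ true
boxAdj-G-edge G H {x = x} uv with x ≟ x
... | yes _  rewrite uv = ∨-zeroʳ _
... | no x≢x = contradiction refl x≢x

boxAdj-H-edge : (G H : Graph) {u : Fin (n G)} {x y : Fin (n H)} →
  adj H x y ≡ true → boxAdj G H (u , x) (u , y) ≡ true
boxAdj-H-edge G H {u} xy with u ≟ u
... | yes _  rewrite xy = refl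
... | no u≢u = contradiction refl u≢u

module Gadget (G H : Graph) (part : Fin (n H) → Bool) (δ χ₀ : ℕ)
  (degB : ∀ y → part y ≡ true → δ ≤ degree H y)
  (K : Fin (n G) → Fin (χ₀ + δ) → ℕ) (K-inj : IsKAssignment (χ₀ + δ) K)
  (L : Fin (n G) → Fin χ₀ → ℕ) (L-inj : IsKAssignment χ₀ L) where

  neighbors : Fin (n H) → List (Fin (n H))
  neighbors y = filter (T? ∘ adj H y) (allFin (n H))

  B-vertices : List (Fin (n H))
  B-vertices = filter (T? ∘ part) (allFin (n H))

  families : List (Fin (n H) → Fin (n G) → ℕ)
  families = selections (n H) part (lColorings G K) (λ _ → 0)

  label : Fin (n H) → Fin (n H) → Fin (n G) → ℕ
  label = assign _≟_ B-vertices families (λ _ _ → 0)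

  δ≤#neighbors : ∀ y → part y ≡ true → δ ≤ length (neighbors y)
  δ≤#neighbors y y∈B = subst (δ ≤_) (sym (length-filter-T? (adj H y) (allFin (n H)))) (degB y y∈B)

  neighbor : (y : Fin (n H)) → .(part y ≡ true) → Fin δ → Fin (n H)
  neighbor y y∈B t = lookup (neighbors y) (inject≤ t (δ≤#neighbors y y∈B))

  copyColor : Fin (n H) → ℕ → ℕ
  copyColor x m = encode (n H) m (inject₁ x)

  extraColor : ℕ → ℕ
  extraColor m = encode (n H) m (fromℕ (n H))

  listA : Fin (n G) → Fin (n H) → Fin (χ₀ + δ) → ℕ
  listA u x i = copyColor x (K u i)

  lColors : Fin (n G) → Fin χ₀ → ℕ
  lColors u j = extraColor (L u j)

  neighborColors : Fin (n G) → (y : Fin (n H)) → .(part y ≡ true) → Fin δ → ℕ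
  neighborColors u y y∈B t = let x = neighbor y y∈B t in copyColor x (label y x u)

  listB : Fin (n G) → (y : Fin (n H)) → .(part y ≡ true) → Fin (χ₀ + δ) → ℕ
  listB u y y∈B = lColors u Vector.++ neighborColors u y y∈B

  listAt : Fin (n G) → (y : Fin (n H)) (b : Bool) → .(part y ≡ b) → Fin (χ₀ + δ) → ℕ
  listAt u y false _   = listA u y
  listAt u y true  y∈B = listB u y y∈B

  gadget : Fin (n G) × Fin (n H) → Fin (χ₀ + δ) → ℕ
  gadget (u , y) = listAt u y (part y) refl

  neighbor-injective : ∀ y .(y∈B : part y ≡ true) → Injective _≡_ _≡_ (neighbor y y∈B)
  neighbor-injective y y∈B eq =
    inject≤-injective _ _ _ _ (lookup-injective (Unique.filter⁺ _ (Unique.allFin⁺ (n H))) _ _ eq)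

  listAt-injective : ∀ u y b .(e : part y ≡ b) → Injective _≡_ _≡_ (listAt u y b e)
  listAt-injective u y false _ eq = K-inj u (proj₁ (encode-injective (n H) eq))
  listAt-injective u y true y∈B =
    ++-injective-disjoint
      (λ eq → L-inj u (proj₁ (encode-injective (n H) eq)))
      (λ eq → neighbor-injective y y∈B (inject₁-injective (proj₂ (encode-injective (n H) eq))))
      (λ _ _ eq → fromℕ≢inject₁ (proj₂ (encode-injective (n H) eq)))

  gadget-isKAssignment : IsKAssignment (χ₀ + δ) gadget
  gadget-isKAssignment (u , y) = listAt-injective u y (part y) refl

  module _ (bip : IsBipartition H part)
    (enough : numLColorings G K ^ countᵇ (not ∘ part) ≤ countᵇ part)
    (c : Fin (n G) × Fin (n H) → ℕ) (c-proper : IsProperLColoring (boxAdj G H) gadget c) where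

    proper : ∀ p q → boxAdj G H p q ≡ true → c p ≢ c q
    proper = proj₂ c-proper

    colorAt : ∀ u y b (e : part y ≡ b) → ∃ λ i → listAt u y b e i ≡ c (u , y)
    colorAt u y b refl = proj₁ c-proper (u , y)

    Matches : Fin (n H) → (Fin (n G) → ℕ) → Set
    Matches x o = ∀ u → copyColor x (o u) ≡ c (u , x)

    copyColoring : ∀ {x} → part x ≡ false → Fin (n G) → ℕ
    copyColoring x∈A u = K u (proj₁ (colorAt u _ false x∈A))

    copyColoring-matches : ∀ {x} (x∈A : part x ≡ false) → Matches x (copyColoring x∈A)
    copyColoring-matches x∈A u = proj₂ (colorAt u _ false x∈A)

    copyColoring-proper : ∀ {x} (x∈A : part x ≡ false) → IsProperLColoring (adj G) K (copyColoring x∈A)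
    copyColoring-proper x∈A =
      (λ u → proj₁ (colorAt u _ false x∈A) , refl) ,
      λ u v uv eq → proper (u , _) (v , _) (boxAdj-G-edge G H uv)
        (trans (sym (copyColoring-matches x∈A u))
               (trans (cong (copyColor _) eq) (copyColoring-matches x∈A v)))

    matchingFamily : Any (λ Ψ → ∀ x → part x ≡ false → Matches x (Ψ x)) families
    matchingFamily = selections-complete Matches λ x x∈A →
      Any.map (λ o≗ u → trans (cong (copyColor x) (o≗ u)) (copyColoring-matches x∈A u))
              (lColorings-complete G K (copyColoring-proper x∈A))

    families-fit : length families ≤ length B-vertices
    families-fit = subst₂ _≤_
      (sym (trans (length-selections part (lColorings G K) _)
                  (cong (_^ countᵇ (not ∘ part)) (length-lColorings G K))))
      (sym (length-filter-T? part (allFin (n H))))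
      enough

    matchingVertex : ∃ λ y → y ∈ B-vertices × ∀ x → part x ≡ false → Matches x (label y x)
    matchingVertex = assign-covers _≟_ _ (Unique.filter⁺ _ (Unique.allFin⁺ (n H))) families-fit matchingFamily

    fromL : ∀ {y} → part y ≡ true → (∀ x → part x ≡ false → Matches x (label y x)) →
            ∀ u → ∃ λ j → extraColor (L u j) ≡ c (u , y)
    fromL {y} y∈B matches u with colorAt u y true y∈B
    ... | i , eq with splitAt χ₀ i
    ... | inj₁ j = j , eq
    -- a neighbor color at (u, y) is the color that c gives the adjacent vertex (u, x)
    ... | inj₂ t = contradiction (trans (sym eq) (matches x x∈A u))
                                 (proper (u , y) (u , x) (boxAdj-H-edge G H yx))
      where
      x : Fin (n H)
      x = neighbor y y∈B t
      yx : adj H y x ≡ true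
      yx = Equivalence.to T-≡ (All.lookup (All.all-filter (T? ∘ adj H y) (allFin (n H))) (∈-lookup _))
      x∈A : part x ≡ false
      x∈A = trans (¬-not (λ eq → bip y x yx (sym eq))) (cong not y∈B)

    lColoringAt : ∀ {y} → part y ≡ true → (∀ x → part x ≡ false → Matches x (label y x)) →
                  ∃ λ d → IsProperLColoring (adj G) L d
    lColoringAt {y} y∈B matches =
      (λ u → L u (proj₁ (yFromL u))) ,
      (λ u → proj₁ (yFromL u) , refl) ,
      λ u v uv eq → proper (u , y) (v , y) (boxAdj-G-edge G H uv)
        (trans (sym (proj₂ (yFromL u))) (trans (cong extraColor eq) (proj₂ (yFromL v))))
      where
      yFromL : ∀ u → ∃ λ j → extraColor (L u j) ≡ c (u , y)
      yFromL = fromL y∈B matches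

    lColoring : ∃ λ d → IsProperLColoring (adj G) L d
    lColoring =
      let y , y∈Bs , matches = matchingVertex
      in lColoringAt (Equivalence.to T-≡ (proj₂ (∈-filter⁻ (T? ∘ part) {xs = allFin (n H)} y∈Bs))) matches

Choosable-box⇒Choosable : (G H : Graph) (part : Fin (n H) → Bool) → IsBipartition H part →
  (δ χ₀ : ℕ) → (∀ y → part y ≡ true → δ ≤ degree H y) →
  (K : Fin (n G) → Fin (χ₀ + δ) → ℕ) → IsKAssignment (χ₀ + δ) K →
  numLColorings G K ^ countᵇ (not ∘ part) ≤ countᵇ part →
  Choosable (boxAdj G H) (χ₀ + δ) → Choosable (adj G) χ₀
Choosable-box⇒Choosable G H part bip δ χ₀ degB K K-inj enough choose L L-inj =
  let c , c-proper = choose gadget gadget-isKAssignment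
  in lColoring bip enough c c-proper
  where open Gadget G H part δ χ₀ degB K K-inj L L-inj

theorem1p7 : (G H : Graph) (part : Fin (n H) → Bool) → IsBipartition H part →
               (a b δ χ p : ℕ) →
               a ≡ countᵇ (λ v → not (part v)) → b ≡ countᵇ part →
               IsMinDegreeOnB H part δ →
               IsListChromaticNumber (adj G) χ →
               IsListColorFunctionValue G (χ + δ ∸ 1) p →
               p ^ a ≤ b →
               (χ' : ℕ) → IsListChromaticNumber (boxAdj G H) χ' →
               χ + δ ≤ χ'
theorem1p7 G _ _ _ _ _ _ zero _ _ _ _ (choosableG , _) _ _ _ _ =
  ⊥-elim (¬Choosable-zero G choosableG)
theorem1p7 G H part bip _ _ δ (suc χ₀) _ refl refl (_ , degB) (_ , minimalG)
           ((K , K-inj , refl) , _) enough χ′ (choosableGH , _) =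
  ≮⇒≥ λ χ′<χ+δ → minimalG χ₀ (n<1+n χ₀)
    (Choosable-box⇒Choosable G H part bip δ χ₀ degB K K-inj enough
      (Choosable-mono (boxAdj G H) (s≤s⁻¹ χ′<χ+δ) choosableGH))
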